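{- Let $n\ge 2$ be an integer with prime factorisation $n=\prod_{i=1}^m \varphi_i^{a_i}$ where $\varphi_1<\varphi_2<\dots<\varphi_m$ are primes and $a_i\ge 1$, and let $x>1$ be an integer; let $\omega_n$ be the number of distinct prime factors of $x^n-1$. Fix $\alpha\in\{1,\dots,m\}$, let $\tau$ be the index with $\varphi_\alpha\in\Pi_n^\tau$ and $b$ the index with $\varphi_\alpha=r_{b,\tau}$. For a tuple $(k_0,\dots,k_m)$ define $\delta_\alpha(j)$, $j\in\{0,\dots,m\}$, as follows. If $\varphi_\alpha\mid x^n-1$: $\delta_\alpha(\tau)=\varphi_\alpha/r_{k_\tau,\tau}$ if $k_\tau<b$, $\delta_\alpha(\alpha)=\varphi_\alpha^{a_\alpha}$, and $\delta_\alpha(j)=1$ in all other cases. If $\varphi_\alpha\nmid x^n-1$: $\delta_\alpha(\tau)=r_{k_\tau+1,\tau}/\varphi_\alpha$ if $k_\tau\ge b$, and $\delta_\alpha(j)=1$ in all other cases. Then $$x\;\ge\;\min\left[\,\max\left\{\left(1+\prod_{j=0}^{t}\delta_\alpha(j)\prod_{i=1}^{k_j} r_{i,j}\right)^{T(t)}\;\middle|\; t\in\{0,\dots,m\}\right\}\;\middle|\;(k_0,\dots,k_m)\in\mathbb{Z}_{\ge0}^{m+1},\ \sum_{s=0}^m k_s=\omega_n\right],$$ where in the minimum only those tuples are admitted for which every prime $r_{i,j}$ occurring in the expression (including in $\delta_\alpha$) is defined, i.e. $1\le i\le|\Pi_n^j|$.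
   Context: Set $\varphi_0:=1$. For $j\in\{0,\dots,m\}$ let $\Pi_n^j$ be the set of primes $\rho$ with $\rho\equiv1\pmod{\varphi_j}$ and $\rho\not\equiv1\pmod{\varphi_i}$ for all $i$ with $j<i\le m$ (vacuous first condition for $j=0$); these partition the primes. $r_{i,j}$ is the $i$-th smallest element of $\Pi_n^j$. $T(t)=\prod_{k=1}^t\varphi_k^{ -a_k}$. Empty products equal $1$. (One has $\tau<\alpha$.) -}

module Defs where

open import Data.Nat using (ℕ; zero; suc; _+_; _*_; _∸_; _^_; _≤_; _<_; _≤ᵇ_; _<ᵇ_)
open import Data.Nat.Divisibility using (_∣_; _∣?_)
open import Data.Nat.Primality using (Prime; prime?)
open import Data.Fin using (Fin; toℕ) renaming (zero to fzero; suc to fsuc; _<_ to _<F_)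
open import Data.Fin.Properties using (all?) renaming (_<?_ to _<F?_; _≟_ to _≟F_)
open import Data.List using (List; length; filter; upTo)
open import Data.Integer using (+_)
open import Data.Rational as Q using (ℚ; 0ℚ; 1ℚ)
open import Data.Bool using (Bool; true; false; if_then_else_; _∧_; not)
open import Data.Product using (_×_)
open import Relation.Nullary using (¬_; Dec; does; ¬?)
open import Relation.Nullary.Decidable using (_×-dec_; _→-dec_)
open import Relation.Binary.PropositionalEquality using (_≡_)

-- The primes φ_1 < … < φ_m of n are given as p : Fin m → ℕ (p i = φ_{i+1});
-- indices j ∈ {0,…,m} are Fin (suc m), with φ_0 := 1.
φ : ∀ {m} → (Fin m → ℕ) → Fin (suc m) → ℕ
φ p fzero = 1
φ p (fsuc i) = p i

InPi : ∀ {m} → (Fin m → ℕ) → Fin (suc m) → ℕ → Set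
InPi p j ρ = Prime ρ × (φ p j ∣ ρ ∸ 1) × (∀ i → j <F i → ¬ (φ p i ∣ ρ ∸ 1))

inPi? : ∀ {m} (p : Fin m → ℕ) (j : Fin (suc m)) (ρ : ℕ) → Dec (InPi p j ρ)
inPi? p j ρ = prime? ρ ×-dec (φ p j ∣? (ρ ∸ 1))
              ×-dec all? (λ i → (j <F? i) →-dec ¬? (φ p i ∣? (ρ ∸ 1)))

countBelow : ∀ {m} → (Fin m → ℕ) → Fin (suc m) → ℕ → ℕ
countBelow p j r = length (filter (inPi? p j) (upTo r))

-- IsNth p j i r : r is r_{i,j}, the i-th smallest element of Π_n^j (i ≥ 1).
IsNth : ∀ {m} → (Fin m → ℕ) → Fin (suc m) → ℕ → ℕ → Set
IsNth p j i r = (1 ≤ i) × InPi p j r × (countBelow p j r ≡ i ∸ 1)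

omega : ℕ → ℕ → ℕ
omega x n = length (filter (λ q → prime? q ×-dec (q ∣? (x ^ n ∸ 1))) (upTo (x ^ n)))

sumFin : ∀ {m} → (Fin m → ℕ) → ℕ
sumFin {zero} f = 0
sumFin {suc m} f = f fzero + sumFin (λ i → f (fsuc i))

prodFin : ∀ {m} → (Fin m → ℕ) → ℕ
prodFin {zero} f = 1
prodFin {suc m} f = f fzero * prodFin (λ i → f (fsuc i))

prodFinℚ : ∀ {m} → (Fin m → ℚ) → ℚ
prodFinℚ {zero} f = 1ℚ
prodFinℚ {suc m} f = f fzero Q.* prodFinℚ (λ i → f (fsuc i))

prodRange : (ℕ → ℕ) → ℕ → ℕ
prodRange f zero = 1
prodRange f (suc k) = prodRange f k * f (suc k)

fromℕ : ℕ → ℚ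
fromℕ k = + k Q./ 1

-- a / r as a rational (r is always a prime when used; r = 0 never occurs)
divQ : ℕ → ℕ → ℚ
divQ a zero = 0ℚ
divQ a (suc r) = + a Q./ suc r

DivCase : ∀ {m} → (Fin m → ℕ) → Fin m → ℕ → ℕ → Bool
DivCase p α x n = does (p α ∣? (x ^ n ∸ 1))

-- δ_α(j), with R j i standing for r_{i,j}
delta : ∀ {m} (p a : Fin m → ℕ) (x n : ℕ) (α : Fin m) (τ : Fin (suc m)) (b : ℕ)
        (k : Fin (suc m) → ℕ) (R : Fin (suc m) → ℕ → ℕ) → Fin (suc m) → ℚ
delta p a x n α τ b k R j =
  if DivCase p α x n
  then (if does (j ≟F τ) ∧ (k τ <ᵇ b) then divQ (p α) (R τ (k τ))
        else if does (j ≟F fsuc α) then fromℕ (p α ^ a α) else 1ℚ)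
  else (if does (j ≟F τ) ∧ (b ≤ᵇ k τ) then divQ (R τ (suc (k τ))) (p α) else 1ℚ)

base : ∀ {m} (p a : Fin m → ℕ) (x n : ℕ) (α : Fin m) (τ : Fin (suc m)) (b : ℕ)
       (k : Fin (suc m) → ℕ) (R : Fin (suc m) → ℕ → ℕ) → Fin (suc m) → ℚ
base p a x n α τ b k R t =
  1ℚ Q.+ prodFinℚ (λ j → if toℕ j ≤ᵇ toℕ t
                           then delta p a x n α τ b k R j Q.* fromℕ (prodRange (R j) (k j))
                           else 1ℚ)

-- 1 / T(t) = ∏_{k=1}^{t} φ_k^{a_k}
invT : ∀ {m} (p a : Fin m → ℕ) → Fin (suc m) → ℕ
invT p a t = prodFin (λ i → if toℕ i <ᵇ toℕ t then p i ^ a i else 1)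

-- RootLe A N x  means  A^{1/N} ≤ x  (for A ≥ 0, N ≥ 1, x ≥ 0), i.e. A ≤ x^N.
RootLe : ℚ → ℕ → ℕ → Set
RootLe A N x = A Q.≤ fromℕ (x ^ N)

Admissible : ∀ {m} (p : Fin m → ℕ) (x n : ℕ) (α : Fin m) (τ : Fin (suc m)) (b : ℕ)
             (k : Fin (suc m) → ℕ) (R : Fin (suc m) → ℕ → ℕ) → Set
Admissible p x n α τ b k R =
  (∀ j i → 1 ≤ i → i ≤ k j → IsNth p j i (R j i))
  × (DivCase p α x n ≡ true → k τ < b → IsNth p τ (k τ) (R τ (k τ)))
  × (DivCase p α x n ≡ false → b ≤ k τ → IsNth p τ (suc (k τ)) (R τ (suc (k τ))))

{-# OPTIONS --safe #-}
module Submission where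

open import Defs
open import Data.Nat
open import Data.Nat.Properties
open import Data.Nat.Divisibility
open import Data.Nat.Primality
open import Data.Nat.GCD using (gcd; gcd-GCD; gcd[m,n]∣m; gcd[m,n]∣n; module Bézout)
open import Data.Nat.Coprimality as Coprime using (Coprime; coprime-divisor; gcd≡1⇒coprime; 1-coprimeTo)
open import Data.Nat.Combinatorics using (_C_; nCk≡n!/k![n-k]!; k![n∸k]!∣n!; nCn≡1)
open import Data.Nat.DivMod using (m/n*n≡m)
open import Data.Nat.Tactic.RingSolver using (solve-∀)
open import Data.Fin as Fin using (Fin; toℕ; inject₁) renaming (zero to fzero; suc to fsuc; _<_ to _<F_)
open import Data.Fin.Properties using (toℕ-inject₁; toℕ-fromℕ; toℕ<n; all?)
  renaming (suc-injective to fsuc-injective; <-cmp to <-cmpF; _<?_ to _<F?_; _≟_ to _≟F_)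
open import Data.Bool using (Bool; true; false; if_then_else_; _∧_; _∨_; not)
open import Data.Bool.Properties using (∧-identityʳ; ∧-zeroʳ; ∨-identityʳ; ∨-zeroʳ; if-eta)
open import Data.List using (length; filter; upTo; _++_; [_])
open import Data.List.Properties using (upTo-∷ʳ; filter-++; length-++)
open import Data.Product using (∃-syntax; ∃₂; _×_; _,_; proj₁; proj₂)
open import Data.Rational using (ℚ; 1ℚ)
open import Data.Sum using (_⊎_; inj₁; inj₂)
open import Function using (_∘_; flip)
open import Relation.Binary using (tri<; tri≈; tri>)
open import Relation.Binary.PropositionalEquality hiding ([_])
open import Relation.Nullary using (¬_; contradiction; Dec; yes; no; does; ofʸ; ofⁿ)
open import Relation.Nullary.Decidable using (dec-true; dec-false; _→-dec_; _×-dec_; ¬?)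
open import Relation.Unary using (Pred; Decidable)
open import Algebra.Properties.Monoid.Sum +-0-monoid using (sum; sum-init-last; sum-cong-≗)
open import Algebra.Properties.CommutativeSemiring.Binomial +-*-commutativeSemiring
  using (binomialExpansion; theorem)
import Algebra.Definitions.RawMonoid +-0-rawMonoid as Mult
import Algebra.Properties.Semiring.Exp +-*-semiring as Exp

-- Take k_j to be the number of prime divisors of x^n − 1 in Π^j, so that Σ k_j = ω_n, and fix t.
-- Write N = 1/T(t) = ∏_{i ≤ t} φ_i^{a_i}.  A prime q ∈ Π^j with j ≤ t dividing x^n − 1 divides x^N − 1:
-- n/N is a product of powers of the φ_i with i > t, all prime to q − 1, while the order of x modulo q
-- divides q − 1 (Fermat).  If φ_α ∣ x^n − 1 and α ≤ t, lifting the exponent even gives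
-- φ_α^{a_α + 1} ∣ x^N − 1.  So the product of all these prime divisors, times φ_α^{a_α} in the latter
-- case, divides x^N − 1 and is therefore below x^N.  Since the product of the k_j smallest elements of
-- Π^j is at most that of any k_j of its elements, and δ_α(τ) merely trades φ_α for r_{k_τ,τ} (if φ_α is
-- among the divisors) or for r_{k_τ+1,τ} (if it is not), 1 + ∏_{j ≤ t} δ_α(j) ∏_{i ≤ k_j} r_{i,j} ≤ x^N.

private variable a d p q n : ℕ

-- Fermat's little theorem

-- The binomial theorem of the library is stated with the semiring operations _×_ and _^_.
×≡* : ∀ m n → m Mult.× n ≡ m * n
×≡* zero    n = refl
×≡* (suc m) n = cong (n +_) (×≡* m n)

^≡^ : ∀ a n → a Exp.^ n ≡ a ^ n
^≡^ a zero    = refl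
^≡^ a (suc n) = cong (a *_) (^≡^ a n)

∣-sum : ∀ {n} (f : Fin n → ℕ) → (∀ i → d ∣ f i) → d ∣ sum f
∣-sum {n = zero}  f d∣f = _ ∣0
∣-sum {n = suc n} f d∣f = ∣m∣n⇒∣m+n (d∣f fzero) (∣-sum (λ i → f (fsuc i)) (λ i → d∣f (fsuc i)))

prime∤1 : Prime p → ¬ p ∣ 1
prime∤1 pr = nonTrivial⇒≢1 {{prime⇒nonTrivial pr}} ∘ ∣1⇒≡1

prime∤! : Prime p → n < p → ¬ p ∣ n !
prime∤! {n = zero}  pr n<p p∣1 = prime∤1 pr p∣1
prime∤! {n = suc n} pr n<p p∣n! with euclidsLemma (suc n) (n !) pr p∣n!
... | inj₁ p∣n = <⇒≱ n<p (∣⇒≤ p∣n)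
... | inj₂ p∣n! = prime∤! pr (<-trans (n<1+n n) n<p) p∣n!

nCk*k![n∸k]!≡n! : ∀ n k → k ≤ n → (n C k) * (k ! * (n ∸ k) !) ≡ n !
nCk*k![n∸k]!≡n! n k k≤n = begin
  (n C k) * (k ! * (n ∸ k) !)     ≡⟨ cong (_* (k ! * (n ∸ k) !)) (nCk≡n!/k![n-k]! k≤n) ⟩
  n ! / (k ! * (n ∸ k) !) * _   ≡⟨ m/n*n≡m (k![n∸k]!∣n! k≤n) ⟩
  n ! ∎
  where open ≡-Reasoning
        instance _ = k !* (n ∸ k) !≢0

prime∣pCk : ∀ {k} → Prime p → 0 < k → k < p → p ∣ p C k
prime∣pCk {p = suc p-1} {k} pr 0<k k<p
  with euclidsLemma (suc p-1 C k) (k ! * (suc p-1 ∸ k) !) pr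
         (subst (suc p-1 ∣_) (sym (nCk*k![n∸k]!≡n! (suc p-1) k (<⇒≤ k<p))) (m∣m*n (p-1 !)))
... | inj₁ p∣C = p∣C
... | inj₂ p∣!*! with euclidsLemma (k !) ((suc p-1 ∸ k) !) pr p∣!*!
...   | inj₁ p∣k! = contradiction p∣k! (prime∤! pr k<p)
...   | inj₂ p∣[p-k]! = contradiction p∣[p-k]! (prime∤! pr (∸-monoʳ-< 0<k (<⇒≤ k<p)))

binomial-term : ∀ n a (k : Fin (suc n)) →
  (n C toℕ k) Mult.× (a Exp.^ toℕ k * 1 Exp.^ (n ∸ toℕ k)) ≡ (n C toℕ k) * a ^ toℕ k
binomial-term n a k = begin
  (n C toℕ k) Mult.× (a Exp.^ toℕ k * 1 Exp.^ (n ∸ toℕ k))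
    ≡⟨ ×≡* (n C toℕ k) _ ⟩
  (n C toℕ k) * (a Exp.^ toℕ k * 1 Exp.^ (n ∸ toℕ k))
    ≡⟨ cong₂ (λ u v → (n C toℕ k) * (u * v)) (^≡^ a (toℕ k))
             (trans (^≡^ 1 (n ∸ toℕ k)) (^-zeroˡ (n ∸ toℕ k))) ⟩
  (n C toℕ k) * (a ^ toℕ k * 1)
    ≡⟨ cong ((n C toℕ k) *_) (*-identityʳ (a ^ toℕ k)) ⟩
  (n C toℕ k) * a ^ toℕ k ∎
  where open ≡-Reasoning

freshman's-dream : Prime p → ∀ a → ∃[ M ] p ∣ M × suc a ^ p ≡ suc (M + a ^ p)
freshman's-dream {p = p@(suc p-1)} pr a = M , p∣M , (begin
  suc a ^ p                        ≡⟨ cong (_^ p) (+-comm 1 a) ⟩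
  (a + 1) ^ p                      ≡⟨ ^≡^ (a + 1) p ⟨
  (a + 1) Exp.^ p                  ≡⟨ theorem p a 1 ⟩
  binomialExpansion a 1 p          ≡⟨ sum-cong-≗ (binomial-term p a) ⟩
  sum term                         ≡⟨ cong (term fzero +_) (sum-init-last (λ i → term (fsuc i))) ⟩
  term fzero + (M + term (fsuc (Fin.fromℕ p-1)))
    ≡⟨ cong (λ v → 1 + (M + v)) last ⟩
  suc (M + a ^ p) ∎)
  where
    open ≡-Reasoning
    term : Fin (suc p) → ℕ
    term k = (p C toℕ k) * a ^ toℕ k
    M = sum (λ i → term (fsuc (inject₁ i)))
    p∣M : p ∣ M
    p∣M = ∣-sum _ λ i → ∣m⇒∣m*n _
      (prime∣pCk pr z<s (subst (_< p) (cong suc (sym (toℕ-inject₁ i))) (s≤s (toℕ<n i))))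
    last : term (fsuc (Fin.fromℕ p-1)) ≡ a ^ p
    last rewrite toℕ-fromℕ p-1 | nCn≡1 p = +-identityʳ (a ^ p)

m≤m^[1+n] : ∀ m n → m ≤ m ^ suc n
m≤m^[1+n] zero    n = z≤n
m≤m^[1+n] (suc m) n = m≤m*n (suc m) (suc m ^ n) {{m^n≢0 (suc m) n}}

fermat : Prime p → ∀ a → p ∣ a ^ p ∸ a
fermat {p = suc _} pr zero = _ ∣0
fermat {p = p@(suc p-1)} pr (suc a) with freshman's-dream pr a
... | M , p∣M , expand = subst (p ∣_) (sym eq) (∣m∣n⇒∣m+n p∣M (fermat pr a))
  where
    open ≡-Reasoning
    eq : suc a ^ p ∸ suc a ≡ M + (a ^ p ∸ a)
    eq = begin
      suc a ^ p ∸ suc a     ≡⟨ cong (_∸ suc a) expand ⟩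
      M + a ^ p ∸ a         ≡⟨ +-∸-assoc M (m≤m^[1+n] a p-1) ⟩
      M + (a ^ p ∸ a)       ∎

fermat-∤ : Prime p → ¬ p ∣ a → p ∣ a ^ (p ∸ 1) ∸ 1
fermat-∤ {p = p@(suc p-1)} {a} pr p∤a
  with euclidsLemma a (a ^ p-1 ∸ 1) pr (subst (p ∣_) a^p∸a≡a*[a^[p-1]∸1] (fermat pr a))
  where
    open ≡-Reasoning
    a^p∸a≡a*[a^[p-1]∸1] : a ^ p ∸ a ≡ a * (a ^ p-1 ∸ 1)
    a^p∸a≡a*[a^[p-1]∸1] = begin
      a * a ^ p-1 ∸ a       ≡⟨ cong (a * a ^ p-1 ∸_) (*-identityʳ a) ⟨
      a * a ^ p-1 ∸ a * 1   ≡⟨ *-distribˡ-∸ a (a ^ p-1) 1 ⟨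
      a * (a ^ p-1 ∸ 1)     ∎
... | inj₁ p∣a = contradiction p∣a p∤a
... | inj₂ p∣a^[p-1]∸1 = p∣a^[p-1]∸1

-- Prime divisors of x^e − 1

coprime-*ˡ : ∀ {a b c} → Coprime a c → Coprime b c → Coprime (a * b) c
coprime-*ˡ {a} {b} a⊥c b⊥c {i} (i∣ab , i∣c) = b⊥c (coprime-divisor i⊥a i∣ab , i∣c)
  where i⊥a : Coprime i a
        i⊥a = gcd≡1⇒coprime (a⊥c (gcd[m,n]∣n i a , ∣-trans (gcd[m,n]∣m i a) i∣c))

coprime-^ : ∀ {a c} → Coprime a c → ∀ e → Coprime (a ^ e) c
coprime-^ {c = c} a⊥c zero    = 1-coprimeTo c
coprime-^         a⊥c (suc e) = coprime-*ˡ a⊥c (coprime-^ a⊥c e)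

coprime-prodFin : ∀ {m c} (f : Fin m → ℕ) → (∀ i → Coprime (f i) c) → Coprime (prodFin f) c
coprime-prodFin {zero}  {c} f f⊥c = 1-coprimeTo c
coprime-prodFin {suc m}     f f⊥c = coprime-*ˡ (f⊥c fzero) (coprime-prodFin (f ∘ fsuc) (f⊥c ∘ fsuc))

prime∤⇒coprime : ∀ {c} → Prime p → ¬ p ∣ c → Coprime p c
prime∤⇒coprime pr p∤c (i∣p , i∣c) with prime⇒irreducible pr i∣p
... | inj₁ i≡1 = i≡1
... | inj₂ refl = contradiction i∣c p∤c

coprime⇒*∣ : ∀ {a b c} → Coprime a b → a ∣ c → b ∣ c → a * b ∣ c
coprime⇒*∣ {a} {b} a⊥b (divides u c≡ua) b∣c =
  subst (a * b ∣_) (sym (trans c≡ua (*-comm u a)))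
    (*-monoʳ-∣ a (coprime-divisor (Coprime.sym a⊥b) (subst (b ∣_) (trans c≡ua (*-comm u a)) b∣c)))

prime∣prime⇒≡ : ∀ {r} → Prime p → Prime r → p ∣ r → p ≡ r
prime∣prime⇒≡ pr-p pr-r p∣r with prime⇒irreducible pr-r p∣r
... | inj₁ refl = contradiction (∣-refl {1}) (prime∤1 pr-p)
... | inj₂ p≡r  = p≡r

m*n∸1≡m*[n∸1]+[m∸1] : ∀ m n .{{_ : NonZero m}} .{{_ : NonZero n}} → m * n ∸ 1 ≡ m * (n ∸ 1) + (m ∸ 1)
m*n∸1≡m*[n∸1]+[m∸1] (suc m) (suc n) = identity m n
  where identity : ∀ m n → n + m * suc n ≡ suc m * n + m
        identity = solve-∀

module _ (x : ℕ) .{{_ : NonZero x}} where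

  x^[m+n]∸1≡x^m*[x^n∸1]+[x^m∸1] : ∀ m n → x ^ (m + n) ∸ 1 ≡ x ^ m * (x ^ n ∸ 1) + (x ^ m ∸ 1)
  x^[m+n]∸1≡x^m*[x^n∸1]+[x^m∸1] m n = begin
    x ^ (m + n) ∸ 1                    ≡⟨ cong (_∸ 1) (^-distribˡ-+-* x m n) ⟩
    x ^ m * x ^ n ∸ 1                  ≡⟨ m*n∸1≡m*[n∸1]+[m∸1] (x ^ m) (x ^ n) {{m^n≢0 x m}} {{m^n≢0 x n}} ⟩
    x ^ m * (x ^ n ∸ 1) + (x ^ m ∸ 1)  ∎
    where open ≡-Reasoning

  ∣x^m∸1⇒∣x^[m*c]∸1 : ∀ m c → d ∣ x ^ m ∸ 1 → d ∣ x ^ (m * c) ∸ 1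
  ∣x^m∸1⇒∣x^[m*c]∸1 {d} m zero    _ = subst (λ e → d ∣ x ^ e ∸ 1) (sym (*-zeroʳ m)) (d ∣0)
  ∣x^m∸1⇒∣x^[m*c]∸1 {d} m (suc c) d∣x^m∸1 =
    subst (λ e → d ∣ x ^ e ∸ 1) (sym (*-suc m c))
      (subst (d ∣_) (sym (x^[m+n]∸1≡x^m*[x^n∸1]+[x^m∸1] m (m * c)))
        (∣m∣n⇒∣m+n (∣n⇒∣m*n (x ^ m) (∣x^m∸1⇒∣x^[m*c]∸1 m c d∣x^m∸1)) d∣x^m∸1))

  ∣x^[m+n]∸1⇒∣x^n∸1⇒∣x^m∸1 : ∀ m n → d ∣ x ^ (m + n) ∸ 1 → d ∣ x ^ n ∸ 1 → d ∣ x ^ m ∸ 1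
  ∣x^[m+n]∸1⇒∣x^n∸1⇒∣x^m∸1 {d} m n d∣x^[m+n]∸1 d∣x^n∸1 =
    ∣m+n∣m⇒∣n (subst (d ∣_) (x^[m+n]∸1≡x^m*[x^n∸1]+[x^m∸1] m n) d∣x^[m+n]∸1) (∣n⇒∣m*n (x ^ m) d∣x^n∸1)

  ∣x^gcd[m,n]∸1 : ∀ m n → d ∣ x ^ m ∸ 1 → d ∣ x ^ n ∸ 1 → d ∣ x ^ gcd m n ∸ 1
  ∣x^gcd[m,n]∸1 {d} m n d∣x^m∸1 d∣x^n∸1 with Bézout.identity (gcd-GCD m n)
  ... | Bézout.+- u v g+vn≡um = ∣x^[m+n]∸1⇒∣x^n∸1⇒∣x^m∸1 (gcd m n) (v * n)
          (subst (λ e → d ∣ x ^ e ∸ 1) (trans (*-comm m u) (sym g+vn≡um)) (∣x^m∸1⇒∣x^[m*c]∸1 m u d∣x^m∸1))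
          (subst (λ e → d ∣ x ^ e ∸ 1) (*-comm n v) (∣x^m∸1⇒∣x^[m*c]∸1 n v d∣x^n∸1))
  ... | Bézout.-+ u v g+um≡vn = ∣x^[m+n]∸1⇒∣x^n∸1⇒∣x^m∸1 (gcd m n) (u * m)
          (subst (λ e → d ∣ x ^ e ∸ 1) (trans (*-comm n v) (sym g+um≡vn)) (∣x^m∸1⇒∣x^[m*c]∸1 n v d∣x^n∸1))
          (subst (λ e → d ∣ x ^ e ∸ 1) (*-comm m u) (∣x^m∸1⇒∣x^[m*c]∸1 m u d∣x^m∸1))

  prime∣x^n∸1⇒∤x : Prime q → ∀ n .{{_ : NonZero n}} → q ∣ x ^ n ∸ 1 → ¬ q ∣ x
  prime∣x^n∸1⇒∤x {q} pr n@(suc n-1) q∣x^n∸1 q∣x = prime∤1 pr (∣m+n∣m⇒∣n q∣x^n∸1+1 q∣x^n∸1)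
    where
      q∣x^n∸1+1 : q ∣ (x ^ n ∸ 1) + 1
      q∣x^n∸1+1 = subst (q ∣_) (sym (trans (+-comm _ 1) (m+[n∸m]≡n (m^n>0 x n)))) (∣m⇒∣m*n (x ^ n-1) q∣x)

  -- The order of x modulo q divides q − 1 (Fermat) and m r, hence m since r is prime to q − 1.
  ∣x^[m*r]∸1⇒∣x^m∸1 : Prime q → ∀ m r .{{_ : NonZero (m * r)}} →
                      Coprime r (q ∸ 1) → q ∣ x ^ (m * r) ∸ 1 → q ∣ x ^ m ∸ 1
  ∣x^[m*r]∸1⇒∣x^m∸1 {q} pr m r r⊥q-1 q∣x^mr∸1 with g∣m
    where
      g = gcd (m * r) (q ∸ 1)
      g⊥r : Coprime g r
      g⊥r (i∣g , i∣r) = r⊥q-1 (i∣r , ∣-trans i∣g (gcd[m,n]∣n (m * r) (q ∸ 1)))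
      g∣m : g ∣ m
      g∣m = coprime-divisor g⊥r (subst (g ∣_) (*-comm m r) (gcd[m,n]∣m (m * r) (q ∸ 1)))
  ... | divides c m≡cg = subst (λ e → q ∣ x ^ e ∸ 1) (sym (trans m≡cg (*-comm c _)))
          (∣x^m∸1⇒∣x^[m*c]∸1 (gcd (m * r) (q ∸ 1)) c
            (∣x^gcd[m,n]∸1 (m * r) (q ∸ 1) q∣x^mr∸1 (fermat-∤ pr (prime∣x^n∸1⇒∤x pr (m * r) q∣x^mr∸1))))

geometric : ℕ → ℕ → ℕ
geometric z zero    = 0
geometric z (suc k) = 1 + z * geometric z k

[1+w]^k≡1+w*geometric : ∀ w k → suc w ^ k ≡ suc (w * geometric (suc w) k)
[1+w]^k≡1+w*geometric w zero    = cong suc (sym (*-zeroʳ w))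
[1+w]^k≡1+w*geometric w (suc k) =
  trans (cong (suc w *_) ([1+w]^k≡1+w*geometric w k)) (identity w (geometric (suc w) k))
  where identity : ∀ w g → suc w * suc (w * g) ≡ suc (w * (1 + suc w * g))
        identity = solve-∀

geometric[1+qv,k]≡k+q*c : ∀ q v k → ∃[ c ] geometric (suc (q * v)) k ≡ k + q * c
geometric[1+qv,k]≡k+q*c q v zero    = 0 , sym (*-zeroʳ q)
geometric[1+qv,k]≡k+q*c q v (suc k) with geometric[1+qv,k]≡k+q*c q v k
... | c , eq = c + v * k + q * v * c , trans (cong (λ g → 1 + suc (q * v) * g) eq) (identity q v k c)
  where identity : ∀ q v k c → 1 + suc (q * v) * (k + q * c) ≡ suc k + q * (c + v * k + q * v * c)
        identity = solve-∀

-- z^q − 1 = (z − 1)(1 + z + ⋯ + z^{q−1}), and the second factor is ≡ q modulo z − 1, so q divides it.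
q^[1+e]∣z∸1⇒q^[2+e]∣z^q∸1 : ∀ e z .{{_ : NonZero z}} → q ^ suc e ∣ z ∸ 1 → q ^ suc (suc e) ∣ z ^ q ∸ 1
q^[1+e]∣z∸1⇒q^[2+e]∣z^q∸1 {q} e (suc w) q^[1+e]∣w
  with divides v w≡vq ← m*n∣⇒m∣ q (q ^ e) q^[1+e]∣w
  with c , geometric≡q+qc ← geometric[1+qv,k]≡k+q*c q v q =
  subst (q ^ suc (suc e) ∣_) (sym (cong (_∸ 1) ([1+w]^k≡1+w*geometric w q)))
    (subst (_∣ w * geometric (suc w) q) (*-comm (q ^ suc e) q) (*-pres-∣ q^[1+e]∣w q∣geometric))
  where
    q∣geometric : q ∣ geometric (suc w) q
    q∣geometric = divides (1 + c) (begin
      geometric (suc w) q            ≡⟨ cong (λ w → geometric (suc w) q) (trans w≡vq (*-comm v q)) ⟩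
      geometric (suc (q * v)) q      ≡⟨ geometric≡q+qc ⟩
      q + q * c                      ≡⟨ cong (q +_) (*-comm q c) ⟩
      (1 + c) * q                    ∎)
      where open ≡-Reasoning

lifting-the-exponent : ∀ x .{{_ : NonZero x}} m e → q ∣ x ^ m ∸ 1 → q ^ suc e ∣ x ^ (m * q ^ e) ∸ 1
lifting-the-exponent {q} x m zero q∣x^m∸1 =
  subst₂ (λ u v → u ∣ x ^ v ∸ 1) (sym (*-identityʳ q)) (sym (*-identityʳ m)) q∣x^m∸1
lifting-the-exponent {q} x m (suc e) q∣x^m∸1 =
  subst (λ y → q ^ suc (suc e) ∣ y ∸ 1) x^[mq^e]^q≡x^[mq^[1+e]]
    (q^[1+e]∣z∸1⇒q^[2+e]∣z^q∸1 {q} e (x ^ (m * q ^ e)) {{m^n≢0 x (m * q ^ e)}}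
      (lifting-the-exponent x m e q∣x^m∸1))
  where
    x^[mq^e]^q≡x^[mq^[1+e]] : (x ^ (m * q ^ e)) ^ q ≡ x ^ (m * q ^ suc e)
    x^[mq^e]^q≡x^[mq^[1+e]] = trans (^-*-assoc x (m * q ^ e) q) (cong (x ^_) (exponent m (q ^ e) q))
      where exponent : ∀ m u q → m * u * q ≡ m * (q * u)
            exponent = solve-∀

n<m^n : ∀ m n → 2 ≤ m → n < m ^ n
n<m^n m zero    _   = z<s
n<m^n m (suc n) 2≤m = begin-strict
  suc n            ≤⟨ n<m^n m n 2≤m ⟩
  m ^ n            <⟨ m<n+m (m ^ n) (m^n>0 m n) ⟩
  m ^ n + m ^ n    ≡⟨ cong (m ^ n +_) (+-identityʳ (m ^ n)) ⟨
  2 * m ^ n        ≤⟨ *-monoˡ-≤ (m ^ n) 2≤m ⟩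
  m * m ^ n        ∎
  where open ≤-Reasoning
        instance _ = >-nonZero (<-trans z<s 2≤m)

prodFin-cong : ∀ {m} {f g : Fin m → ℕ} → (∀ i → f i ≡ g i) → prodFin f ≡ prodFin g
prodFin-cong {zero}  f≗g = refl
prodFin-cong {suc m} f≗g = cong₂ _*_ (f≗g fzero) (prodFin-cong (f≗g ∘ fsuc))

prodFin-distrib-* : ∀ {m} (f g : Fin m → ℕ) → prodFin (λ i → f i * g i) ≡ prodFin f * prodFin g
prodFin-distrib-* {zero}  f g = refl
prodFin-distrib-* {suc m} f g =
  trans (cong (f fzero * g fzero *_) (prodFin-distrib-* (f ∘ fsuc) (g ∘ fsuc)))
        (interchange (f fzero) (g fzero) _ _)
  where interchange : ∀ a b c d → a * b * (c * d) ≡ a * c * (b * d)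
        interchange = solve-∀

sumFin-distrib-+ : ∀ {m} (f g : Fin m → ℕ) → sumFin (λ i → f i + g i) ≡ sumFin f + sumFin g
sumFin-distrib-+ {zero}  f g = refl
sumFin-distrib-+ {suc m} f g =
  trans (cong (f fzero + g fzero +_) (sumFin-distrib-+ (f ∘ fsuc) (g ∘ fsuc)))
        (interchange (f fzero) (g fzero) _ _)
  where interchange : ∀ a b c d → a + b + (c + d) ≡ a + c + (b + d)
        interchange = solve-∀

prodFin-1 : ∀ {m} (f : Fin m → ℕ) → (∀ i → f i ≡ 1) → prodFin f ≡ 1
prodFin-1 {zero}  f f≗1 = refl
prodFin-1 {suc m} f f≗1 = cong₂ _*_ (f≗1 fzero) (prodFin-1 (f ∘ fsuc) (f≗1 ∘ fsuc))

sumFin-0 : ∀ {m} (f : Fin m → ℕ) → (∀ i → f i ≡ 0) → sumFin f ≡ 0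
sumFin-0 {zero}  f f≗0 = refl
sumFin-0 {suc m} f f≗0 = cong₂ _+_ (f≗0 fzero) (sumFin-0 (f ∘ fsuc) (f≗0 ∘ fsuc))

prodFin-single : ∀ {m} (f : Fin m → ℕ) i → (∀ j → j ≢ i → f j ≡ 1) → prodFin f ≡ f i
prodFin-single {suc m} f fzero    f≗1 =
  trans (cong (f fzero *_) (prodFin-1 (f ∘ fsuc) (λ j → f≗1 (fsuc j) λ ()))) (*-identityʳ (f fzero))
prodFin-single {suc m} f (fsuc i) f≗1 =
  trans (cong₂ _*_ (f≗1 fzero λ ()) (prodFin-single (f ∘ fsuc) i λ j j≢i → f≗1 (fsuc j) (j≢i ∘ fsuc-injective)))
        (*-identityˡ (f (fsuc i)))

sumFin-single : ∀ {m} (f : Fin m → ℕ) i → (∀ j → j ≢ i → f j ≡ 0) → sumFin f ≡ f i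
sumFin-single {suc m} f fzero    f≗0 =
  trans (cong (f fzero +_) (sumFin-0 (f ∘ fsuc) (λ j → f≗0 (fsuc j) λ ()))) (+-identityʳ (f fzero))
sumFin-single {suc m} f (fsuc i) f≗0 =
  cong₂ _+_ (f≗0 fzero λ ()) (sumFin-single (f ∘ fsuc) i (λ j j≢i → f≗0 (fsuc j) (j≢i ∘ fsuc-injective)))

∣-prodFin : ∀ {m} (f : Fin m → ℕ) i → f i ∣ prodFin f
∣-prodFin f fzero    = m∣m*n _
∣-prodFin f (fsuc i) = ∣n⇒∣m*n (f fzero) (∣-prodFin (f ∘ fsuc) i)

𝟙 : Bool → ℕ
𝟙 true  = 1
𝟙 false = 0

count : (ℕ → Bool) → ℕ → ℕ
count f zero    = 0
count f (suc B) = count f B + 𝟙 (f B)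

prod : (ℕ → Bool) → ℕ → ℕ
prod f zero    = 1
prod f (suc B) = prod f B * (if f B then B else 1)

_⊆ᵇ_ : (ℕ → Bool) → (ℕ → Bool) → Set
Q ⊆ᵇ F = ∀ q → Q q ≡ true → F q ≡ true

private variable
  f g Q F : ℕ → Bool
  B : ℕ

count-filter : ∀ {ℓ} {P : Pred ℕ ℓ} (P? : Decidable P) B → length (filter P? (upTo B)) ≡ count (does ∘ P?) B
count-filter P? zero    = refl
count-filter P? (suc B) = begin
  length (filter P? (upTo (suc B)))                        ≡⟨ cong (length ∘ filter P?) (upTo-∷ʳ B) ⟨
  length (filter P? (upTo B ++ [ B ]))                     ≡⟨ cong length (filter-++ P? (upTo B) [ B ]) ⟩
  length (filter P? (upTo B) ++ filter P? [ B ])           ≡⟨ length-++ (filter P? (upTo B)) ⟩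
  length (filter P? (upTo B)) + length (filter P? [ B ])   ≡⟨ cong₂ _+_ (count-filter P? B) length-filter-[B] ⟩
  count (does ∘ P?) B + 𝟙 (does (P? B))                    ∎
  where
    open ≡-Reasoning
    length-filter-[B] : length (filter P? [ B ]) ≡ 𝟙 (does (P? B))
    length-filter-[B] with P? B
    ... | yes _ = refl
    ... | no  _ = refl

count-mono : Q ⊆ᵇ F → ∀ B → count Q B ≤ count F B
count-mono Q⊆F zero    = z≤n
count-mono {Q} {F} Q⊆F (suc B) = +-mono-≤ (count-mono Q⊆F B) (𝟙-mono (Q B) (F B) (Q⊆F B))
  where 𝟙-mono : ∀ b c → (b ≡ true → c ≡ true) → 𝟙 b ≤ 𝟙 c
        𝟙-mono false _     _   = z≤n
        𝟙-mono true  true  _   = ≤-refl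
        𝟙-mono true  false b⇒c with () ← b⇒c refl

count-cong : ∀ B → (∀ q → q < B → f q ≡ g q) → count f B ≡ count g B
count-cong zero    f≗g = refl
count-cong (suc B) f≗g = cong₂ _+_ (count-cong B (λ q q<B → f≗g q (m<n⇒m<1+n q<B))) (cong 𝟙 (f≗g B ≤-refl))

prod-cong : ∀ B → (∀ q → q < B → f q ≡ g q) → prod f B ≡ prod g B
prod-cong zero    f≗g = refl
prod-cong (suc B) f≗g =
  cong₂ _*_ (prod-cong B (λ q q<B → f≗g q (m<n⇒m<1+n q<B))) (cong (if_then B else 1) (f≗g B ≤-refl))

prod-if : ∀ c f B → (if c then prod f B else 1) ≡ prod (λ q → f q ∧ c) B
prod-if true  f B = prod-cong B λ q _ → sym (∧-identityʳ (f q))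
prod-if false f zero    = refl
prod-if false f (suc B) =
  trans (sym (*-identityʳ 1)) (cong₂ _*_ (prod-if false f B) (cong (if_then B else 1) (sym (∧-zeroʳ (f B)))))

count-< : ∀ {s r} → f s ≡ true → s < r → count f s < count f r
count-< {f} {s} {suc r} fs s<1+r with m≤n⇒m<n∨m≡n (s≤s⁻¹ s<1+r)
... | inj₁ s<r  = ≤-trans (count-< fs s<r) (m≤m+n (count f r) _)
... | inj₂ refl rewrite fs = ≤-reflexive (+-comm 1 (count f s))

-- nth f B i is the i-th (counting from i = 1) of the q < B with f q, and 0 if there is none.
nth : (ℕ → Bool) → ℕ → ℕ → ℕ
nth f zero    i = 0
nth f (suc B) i = if i ≤ᵇ count f B then nth f B i else B

nth-spec : ∀ f B i → 1 ≤ i → i ≤ count f B → f (nth f B i) ≡ true × count f (nth f B i) ≡ i ∸ 1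
nth-spec f zero    (suc i) 1≤i ()
nth-spec f (suc B) i 1≤i i≤c with i ≤ᵇ count f B | ≤ᵇ-reflects-≤ i (count f B)
... | true  | ofʸ i≤c′ = nth-spec f B i 1≤i i≤c′
... | false | ofⁿ i≰c′ with f B
...   | false = contradiction (subst (i ≤_) (+-identityʳ (count f B)) i≤c) i≰c′
...   | true  = refl , cong (_∸ 1) (sym (≤-antisym (subst (i ≤_) (+-comm (count f B) 1) i≤c) (≰⇒> i≰c′)))

module _ (F : ℕ → Bool) (B₀ : ℕ) where

  nth≤ : Q ⊆ᵇ F → ∀ B → Q B ≡ true → suc (count Q B) ≤ count F B₀ → nth F B₀ (suc (count Q B)) ≤ B
  nth≤ {Q} Q⊆F B QB c<K = ≮⇒≥ λ B<r → <-irrefl refl (begin-strict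
    count Q B                    ≤⟨ count-mono Q⊆F B ⟩
    count F B                    <⟨ count-< (Q⊆F B QB) B<r ⟩
    count F (nth F B₀ (suc c))   ≡⟨ proj₂ (nth-spec F B₀ (suc c) (s≤s z≤n) c<K) ⟩
    c                            ∎)
    where open ≤-Reasoning
          c = count Q B

  prodRange-nth≤prod : Q ⊆ᵇ F → ∀ B → count Q B ≤ count F B₀ → prodRange (nth F B₀) (count Q B) ≤ prod Q B
  prodRange-nth≤prod Q⊆F zero _ = ≤-refl
  prodRange-nth≤prod {Q} Q⊆F (suc B) c≤K with Q B in QB
  ... | false = subst₂ _≤_ (cong (prodRange (nth F B₀)) (sym (+-identityʳ (count Q B)))) (sym (*-identityʳ (prod Q B)))
                  (prodRange-nth≤prod Q⊆F B (subst (_≤ count F B₀) (+-identityʳ (count Q B)) c≤K))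
  ... | true  = subst (_≤ prod Q B * B) (cong (prodRange (nth F B₀)) (+-comm 1 (count Q B)))
                  (*-mono-≤ (prodRange-nth≤prod Q⊆F B (<⇒≤ c<K)) (nth≤ Q⊆F B QB c<K))
    where c<K : suc (count Q B) ≤ count F B₀
          c<K = subst (_≤ count F B₀) (+-comm (count Q B) 1) c≤K

remove : ℕ → (ℕ → Bool) → ℕ → Bool
remove a f q = f q ∧ not (does (q ≟ a))

insert : ℕ → (ℕ → Bool) → ℕ → Bool
insert a f q = f q ∨ does (q ≟ a)

remove-≢ : ∀ f {a} → q ≢ a → remove a f q ≡ f q
remove-≢ {q} f {a} q≢a rewrite dec-false (q ≟ a) q≢a = ∧-identityʳ (f q)

remove-self : ∀ f a → remove a f a ≡ false
remove-self f a rewrite dec-true (a ≟ a) refl = ∧-zeroʳ (f a)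

remove⊆ : ∀ f a → remove a f ⊆ᵇ f
remove⊆ f a q with f q
... | true  = λ _ → refl
... | false = λ ()

remove-insert : ∀ {a} → f a ≡ false → ∀ q → remove a (insert a f) q ≡ f q
remove-insert {f} {a} fa≡false q with q ≟ a
... | yes refl rewrite dec-true (q ≟ q) refl = trans (∧-zeroʳ _) (sym fa≡false)
... | no  q≢a  rewrite dec-false (q ≟ a) q≢a = trans (∧-identityʳ _) (∨-identityʳ (f q))

insert-self : ∀ f a → insert a f a ≡ true
insert-self f a rewrite dec-true (a ≟ a) refl = ∨-zeroʳ (f a)

remove⇒≢ : ∀ {a} → remove a f q ≡ true → q ≢ a
remove⇒≢ {f} {q} {a} fq refl = contradiction (trans (sym fq) (remove-self f a)) λ ()

count-remove : ∀ {a} → f a ≡ true → a < B → count f B ≡ suc (count (remove a f) B)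
count-remove {f} {suc B} {a} fa a<1+B with m≤n⇒m<n∨m≡n (s≤s⁻¹ a<1+B)
... | inj₁ a<B  = cong₂ (λ c b → c + 𝟙 b) (count-remove fa a<B) (sym (remove-≢ f (<⇒≢ a<B ∘ sym)))
... | inj₂ refl = begin
  count f a + 𝟙 (f a)                         ≡⟨ cong (λ b → count f a + 𝟙 b) fa ⟩
  count f a + 1                               ≡⟨ +-comm (count f a) 1 ⟩
  suc (count f a)                             ≡⟨ cong suc (count-cong a λ q q<a → sym (remove-≢ f (<⇒≢ q<a))) ⟩
  suc (count (remove a f) a)                  ≡⟨ cong suc (+-identityʳ _) ⟨
  suc (count (remove a f) a + 𝟙 false)        ≡⟨ cong (λ b → suc (count (remove a f) a + 𝟙 b)) (remove-self f a) ⟨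
  suc (count (remove a f) a + 𝟙 (remove a f a)) ∎
  where open ≡-Reasoning

prod-remove : ∀ {a} → f a ≡ true → a < B → prod f B ≡ a * prod (remove a f) B
prod-remove {f} {suc B} {a} fa a<1+B with m≤n⇒m<n∨m≡n (s≤s⁻¹ a<1+B)
... | inj₁ a<B  = begin
  prod f B * (if f B then B else 1)
    ≡⟨ cong₂ (λ c b → c * (if b then B else 1)) (prod-remove fa a<B) (sym (remove-≢ f (<⇒≢ a<B ∘ sym))) ⟩
  a * prod (remove a f) B * (if remove a f B then B else 1)   ≡⟨ *-assoc a _ _ ⟩
  a * prod (remove a f) (suc B)                               ∎
  where open ≡-Reasoning
... | inj₂ refl = begin
  prod f a * (if f a then a else 1)                           ≡⟨ cong (λ b → prod f a * (if b then a else 1)) fa ⟩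
  prod f a * a                                                ≡⟨ *-comm (prod f a) a ⟩
  a * prod f a                                                ≡⟨ cong (a *_) (prod-cong a λ q q<a → sym (remove-≢ f (<⇒≢ q<a))) ⟩
  a * prod (remove a f) a                                     ≡⟨ cong (a *_) (*-identityʳ _) ⟨
  a * (prod (remove a f) a * 1)
    ≡⟨ cong (λ b → a * (prod (remove a f) a * (if b then a else 1))) (remove-self f a) ⟨
  a * prod (remove a f) (suc a)                               ∎
  where open ≡-Reasoning

count-insert : ∀ {a} → f a ≡ false → a < B → count (insert a f) B ≡ suc (count f B)
count-insert {f} {B} {a} fa a<B =
  trans (count-remove (insert-self f a) a<B) (cong suc (count-cong B λ q _ → remove-insert fa q))

prod-insert : ∀ {a} → f a ≡ false → a < B → prod (insert a f) B ≡ a * prod f B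
prod-insert {f} {B} {a} fa a<B =
  trans (prod-remove (insert-self f a) a<B) (cong (a *_) (prod-cong B λ q _ → remove-insert fa q))

insert-⊆ᵇ : ∀ {a} → Q ⊆ᵇ F → F a ≡ true → insert a Q ⊆ᵇ F
insert-⊆ᵇ {Q} {F} {a} Q⊆F Fa q with q ≟ a
... | yes refl = λ _ → Fa
... | no  q≢a rewrite dec-false (q ≟ a) q≢a = Q⊆F q ∘ trans (sym (∨-identityʳ (Q q)))

module _ (F : ℕ → Bool) (B₀ : ℕ) where

  prodRange-nth≤prod-remove : Q ⊆ᵇ F → ∀ {a} B → Q a ≡ true → a < B → count Q B ≤ count F B₀ →
                              a * prodRange (nth F B₀) (count Q B) ≤ nth F B₀ (count Q B) * prod Q B
  prodRange-nth≤prod-remove {Q} Q⊆F {a} B Qa a<B c≤K with count Q B | count-remove {Q} Qa a<B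
  ... | _ | refl = begin
    a * (prodRange R c′ * R (suc c′))        ≡⟨ rearrange a (prodRange R c′) (R (suc c′)) ⟩
    R (suc c′) * (a * prodRange R c′)        ≤⟨ *-monoʳ-≤ (R (suc c′)) (*-monoʳ-≤ a
                                                  (prodRange-nth≤prod F B₀ (λ q → Q⊆F q ∘ remove⊆ Q a q) B (<⇒≤ c≤K))) ⟩
    R (suc c′) * (a * prod (remove a Q) B)   ≡⟨ cong (R (suc c′) *_) (prod-remove Qa a<B) ⟨
    R (suc c′) * prod Q B                    ∎
    where
      open ≤-Reasoning
      R = nth F B₀
      c′ = count (remove a Q) B
      rearrange : ∀ a P r → a * (P * r) ≡ r * (a * P)
      rearrange = solve-∀

  prodRange-nth≤prod-insert : Q ⊆ᵇ F → ∀ {a} B → Q a ≡ false → F a ≡ true → a < B → suc (count Q B) ≤ count F B₀ →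
                              nth F B₀ (suc (count Q B)) * prodRange (nth F B₀) (count Q B) ≤ a * prod Q B
  prodRange-nth≤prod-insert {Q} Q⊆F {a} B Qa Fa a<B c<K = begin
    R (suc c) * prodRange R c                 ≡⟨ *-comm (R (suc c)) (prodRange R c) ⟩
    prodRange R (suc c)                       ≡⟨ cong (prodRange R) (count-insert Qa a<B) ⟨
    prodRange R (count (insert a Q) B)        ≤⟨ prodRange-nth≤prod F B₀ (insert-⊆ᵇ Q⊆F Fa) B
                                                   (subst (_≤ count F B₀) (sym (count-insert Qa a<B)) c<K) ⟩
    prod (insert a Q) B                       ≡⟨ prod-insert Qa a<B ⟩
    a * prod Q B                              ∎
    where
      open ≤-Reasoning
      R = nth F B₀
      c = count Q B

prime∤prod : Prime p → (∀ q → q < B → f q ≡ true → Prime q × q ≢ p) → ¬ p ∣ prod f B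
prime∤prod {B = zero}          pr _     = prime∤1 pr
prime∤prod {p} {suc B} {f} pr primes p∣ with euclidsLemma (prod f B) (if f B then B else 1) pr p∣
... | inj₁ p∣prod = prime∤prod pr (λ q q<B → primes q (m<n⇒m<1+n q<B)) p∣prod
... | inj₂ p∣fB with f B in fB
...   | false = prime∤1 pr p∣fB
...   | true  = proj₂ (primes B ≤-refl fB) (sym (prime∣prime⇒≡ pr (proj₁ (primes B ≤-refl fB)) p∣fB))

prod-primes-∣ : ∀ {M} → (∀ q → q < B → f q ≡ true → Prime q × q ∣ M) → prod f B ∣ M
prod-primes-∣ {zero}          {M = M} _ = 1∣ M
prod-primes-∣ {suc B} {f} {M} primes with f B in fB
... | false = subst (_∣ M) (sym (*-identityʳ _)) (prod-primes-∣ below)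
  where below = λ q q<B → primes q (m<n⇒m<1+n q<B)
... | true  =
  coprime⇒*∣ (Coprime.sym (prime∤⇒coprime B-prime B∤prod)) (prod-primes-∣ below) (proj₂ (primes B ≤-refl fB))
  where
    below = λ q q<B → primes q (m<n⇒m<1+n q<B)
    B-prime = proj₁ (primes B ≤-refl fB)
    B∤prod : ¬ B ∣ prod f B
    B∤prod = prime∤prod B-prime λ q q<B fq → proj₁ (below q q<B fq) , <⇒≢ q<B

sumFin-count : ∀ {m} (F : Fin m → ℕ → Bool) G → (∀ q → sumFin (λ j → 𝟙 (F j q)) ≡ 𝟙 (G q)) →
               ∀ B → sumFin (λ j → count (F j) B) ≡ count G B
sumFin-count F G pointwise zero    = sumFin-0 (λ j → count (F j) zero) (λ _ → refl)
sumFin-count F G pointwise (suc B) = trans (sumFin-distrib-+ (λ j → count (F j) B) (λ j → 𝟙 (F j B)))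
                                           (cong₂ _+_ (sumFin-count F G pointwise B) (pointwise B))

prodFin-prod : ∀ {m} (F : Fin m → ℕ → Bool) G →
               (∀ q → prodFin (λ j → if F j q then q else 1) ≡ (if G q then q else 1)) → ∀ B → prodFin (λ j → prod (F j) B) ≡ prod G B
prodFin-prod F G pointwise zero    = prodFin-1 (λ j → prod (F j) zero) (λ _ → refl)
prodFin-prod F G pointwise (suc B) = trans (prodFin-distrib-* (λ j → prod (F j) B) (λ j → if F j B then B else 1))
                                           (cong₂ _*_ (prodFin-prod F G pointwise B) (pointwise B))

module _ where
  open import Data.Integer as ℤ using (+_; +≤+)
  open import Data.Integer.Properties using (pos-*; pos-+)
  open import Data.Rational as ℚ using (0ℚ; toℚᵘ)
  open import Data.Rational.Properties as ℚ using (toℚᵘ-cancel-≤; toℚᵘ-fromℚᵘ; toℚᵘ-homo-*; toℚᵘ-homo-+; toℚᵘ-injective)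
  open import Data.Rational.Unnormalised as ℚᵘ using (mkℚᵘ; *≤*; *≡*) renaming (_≤_ to _≤ᵘ_; _≃_ to _≃ᵘ_)
  import Data.Rational.Unnormalised.Properties as ℚᵘ

  toℚᵘ-divQ : ∀ u r → toℚᵘ (divQ u (suc r)) ≃ᵘ mkℚᵘ (+ u) r
  toℚᵘ-divQ u r = toℚᵘ-fromℚᵘ (mkℚᵘ (+ u) r)

  mkℚᵘ-mono-≤ : ∀ u s v t → u * suc t ≤ v * suc s → mkℚᵘ (+ u) s ≤ᵘ mkℚᵘ (+ v) t
  mkℚᵘ-mono-≤ u s v t u*t≤v*s = *≤* (subst₂ ℤ._≤_ (pos-* u (suc t)) (pos-* v (suc s)) (+≤+ u*t≤v*s))

  divQ-mono-≤ : ∀ u s v t → u * suc t ≤ v * suc s → divQ u (suc s) ℚ.≤ divQ v (suc t)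
  divQ-mono-≤ u s v t le = toℚᵘ-cancel-≤
    (ℚᵘ.≤-respˡ-≃ (ℚᵘ.≃-sym (toℚᵘ-divQ u s)) (ℚᵘ.≤-respʳ-≃ (ℚᵘ.≃-sym (toℚᵘ-divQ v t)) (mkℚᵘ-mono-≤ u s v t le)))

  divQ*fromℕ≡divQ : ∀ u s c → divQ u (suc s) ℚ.* fromℕ c ≡ divQ (u * c) (suc s)
  divQ*fromℕ≡divQ u s c = toℚᵘ-injective (ℚᵘ.≃-trans (toℚᵘ-homo-* (divQ u (suc s)) (fromℕ c))
    (ℚᵘ.≃-trans (ℚᵘ.*-cong (toℚᵘ-divQ u s) (toℚᵘ-divQ c 0))
      (ℚᵘ.≃-trans (*≡* (cong₂ ℤ._*_ (sym (pos-* u c)) (cong (λ z → + suc z) (sym (*-identityʳ s)))))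
        (ℚᵘ.≃-sym (toℚᵘ-divQ (u * c) s)))))

  1+fromℕ≡fromℕ[1+] : ∀ h → 1ℚ ℚ.+ fromℕ h ≡ fromℕ (suc h)
  1+fromℕ≡fromℕ[1+] h = toℚᵘ-injective (ℚᵘ.≃-trans (toℚᵘ-homo-+ 1ℚ (fromℕ h))
    (ℚᵘ.≃-trans (ℚᵘ.+-cong (toℚᵘ-divQ 1 0) (toℚᵘ-divQ h 0))
      (ℚᵘ.≃-sym (ℚᵘ.≃-trans (toℚᵘ-divQ (suc h) 0) (*≡* (cong (ℤ._* + 1) 1+h≡1*1+h*1))))))
    where
      1+h≡1*1+h*1 : + suc h ≡ + 1 ℤ.* + 1 ℤ.+ + h ℤ.* + 1
      1+h≡1*1+h*1 = trans (cong (λ z → + suc z) (sym (*-identityʳ h)))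
                          (trans (pos-+ 1 (h * 1)) (cong (λ z → + 1 ℤ.+ z) (pos-* h 1)))

  fromℕ-mono-≤ : ∀ {a b} → a ≤ b → fromℕ a ℚ.≤ fromℕ b
  fromℕ-mono-≤ {a} {b} a≤b = divQ-mono-≤ a 0 b 0 (*-monoˡ-≤ 1 a≤b)

  divQ*fromℕ≤fromℕ : ∀ u r c d .{{_ : NonZero r}} → u * c ≤ r * d → divQ u r ℚ.* fromℕ c ℚ.≤ fromℕ d
  divQ*fromℕ≤fromℕ u (suc s) c d uc≤rd = subst (ℚ._≤ fromℕ d) (sym (divQ*fromℕ≡divQ u s c))
    (divQ-mono-≤ (u * c) s d 0 (subst₂ _≤_ (sym (*-identityʳ (u * c))) (*-comm (suc s) d) uc≤rd))

  0≤divQ*fromℕ : ∀ u r c .{{_ : NonZero r}} → 0ℚ ℚ.≤ divQ u r ℚ.* fromℕ c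
  0≤divQ*fromℕ u (suc s) c = subst (0ℚ ℚ.≤_) (sym (divQ*fromℕ≡divQ u s c)) (divQ-mono-≤ 0 0 (u * c) s z≤n)

  prodFinℚ≤fromℕ-prodFin : ∀ {m} (G : Fin m → ℚ) (H : Fin m → ℕ) → (∀ j → 0ℚ ℚ.≤ G j × G j ℚ.≤ fromℕ (H j)) →
                           0ℚ ℚ.≤ prodFinℚ G × prodFinℚ G ℚ.≤ fromℕ (prodFin H)
  prodFinℚ≤fromℕ-prodFin {zero}  G H bounds = fromℕ-mono-≤ {0} {1} z≤n , ℚ.≤-refl
  prodFinℚ≤fromℕ-prodFin {suc m} G H bounds
    with 0≤G₀ , G₀≤H₀ ← bounds fzero
       | 0≤∏ , ∏≤ ← prodFinℚ≤fromℕ-prodFin (G ∘ fsuc) (H ∘ fsuc) (bounds ∘ fsuc) =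
    ℚ.nonNegative⁻¹ _ {{ℚ.nonNeg*nonNeg⇒nonNeg (G fzero) {{ℚ.nonNegative 0≤G₀}} _ {{ℚ.nonNegative 0≤∏}}}} ,
    ℚ.≤-trans (ℚ.*-monoʳ-≤-nonNeg (prodFinℚ (G ∘ fsuc)) {{ℚ.nonNegative 0≤∏}} G₀≤H₀)
      (ℚ.≤-trans (ℚ.*-monoˡ-≤-nonNeg (fromℕ (H fzero)) {{ℚ.nonNegative 0≤H₀}} ∏≤)
        (ℚ.≤-reflexive (divQ*fromℕ≡divQ (H fzero) 0 (prodFin (H ∘ fsuc)))))
    where 0≤H₀ = fromℕ-mono-≤ {0} {H fzero} z≤n

  1+≤fromℕ : ∀ {A h M} → A ℚ.≤ fromℕ h → h < M → 1ℚ ℚ.+ A ℚ.≤ fromℕ M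
  1+≤fromℕ {A} {h} A≤h h<M = ℚ.≤-trans (ℚ.+-monoʳ-≤ 1ℚ A≤h)
    (ℚ.≤-trans (ℚ.≤-reflexive (1+fromℕ≡fromℕ[1+] h)) (fromℕ-mono-≤ h<M))

  FractionBound : ℚ → ℕ → ℕ → Set
  FractionBound δ c d = ∃₂ λ u r → NonZero r × δ ≡ divQ u r × u * c ≤ r * d

  FractionBound⇒ : ∀ {δ c d} → FractionBound δ c d → 0ℚ ℚ.≤ δ ℚ.* fromℕ c × δ ℚ.* fromℕ c ℚ.≤ fromℕ d
  FractionBound⇒ {c = c} {d} (u , r , r≢0 , refl , uc≤rd) =
    0≤divQ*fromℕ u r c {{r≢0}} , divQ*fromℕ≤fromℕ u r c d {{r≢0}} uc≤rd

  if-bound : ∀ b {δ d} → 0ℚ ℚ.≤ δ × δ ℚ.≤ fromℕ d →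
             0ℚ ℚ.≤ (if b then δ else 1ℚ) × (if b then δ else 1ℚ) ℚ.≤ fromℕ (if b then d else 1)
  if-bound true  bound = bound
  if-bound false _     = fromℕ-mono-≤ {0} {1} z≤n , ℚ.≤-refl

-- The classes Π^j

does-true⇒ : ∀ {ℓ} {P : Set ℓ} (P? : Dec P) → does P? ≡ true → P
does-true⇒ (yes p) _ = p

none⊎greatest : ∀ {m ℓ} {P : Pred (Fin m) ℓ} → Decidable P →
                (∀ i → ¬ P i) ⊎ ∃[ j ] P j × (∀ i → j <F i → ¬ P i)
none⊎greatest {zero}  P? = inj₁ λ ()
none⊎greatest {suc m} P? with none⊎greatest (P? ∘ fsuc) | P? fzero
... | inj₂ (j , Pj , above) | _     = inj₂ (fsuc j , Pj , λ where (fsuc i) (s≤s j<i) → above i j<i)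
... | inj₁ none             | yes P₀ = inj₂ (fzero , P₀ , λ where (fsuc i) _ → none i)
... | inj₁ none             | no ¬P₀ = inj₁ λ where fzero → ¬P₀ ; (fsuc i) → none i

module _ {m} (p : Fin m → ℕ) where

  InPi-unique : ∀ {j j′ q} → InPi p j q → InPi p j′ q → j ≡ j′
  InPi-unique {j} {j′} (_ , φj∣ , above) (_ , φj′∣ , above′) with <-cmpF j j′
  ... | tri< j<j′ _ _ = contradiction φj′∣ (above j′ j<j′)
  ... | tri≈ _ j≡j′ _ = j≡j′
  ... | tri> _ _ j′<j = contradiction φj∣ (above′ j j′<j)

  InPi-exists : Prime q → ∃[ j ] InPi p j q
  InPi-exists {q} pr with none⊎greatest (λ j → φ p j ∣? (q ∸ 1))
  ... | inj₁ none              = contradiction (1∣ (q ∸ 1)) (none fzero)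
  ... | inj₂ (j , φj∣ , above) = j , pr , φj∣ , above

  -- For a prime q, InPi≤ t q says that q lies in Π^j for some j ≤ t.
  InPi≤ : Fin (suc m) → ℕ → Set
  InPi≤ t q = ∀ i → t <F i → ¬ φ p i ∣ q ∸ 1

  inPi≤? : ∀ t q → Dec (InPi≤ t q)
  inPi≤? t q = all? (λ i → (t <F? i) →-dec ¬? (φ p i ∣? (q ∸ 1)))

  InPi⇒InPi≤ : ∀ {j t} → InPi p j q → toℕ j ≤ toℕ t → InPi≤ t q
  InPi⇒InPi≤ (_ , _ , above) j≤t i t<i = above i (≤-<-trans j≤t t<i)

  InPi≤⇒≤ : ∀ {j t} → InPi p j q → InPi≤ t q → toℕ j ≤ toℕ t
  InPi≤⇒≤ {j = j} (_ , φj∣ , _) below = ≮⇒≥ λ t<j → below j t<j φj∣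

module Setting
  (n m : ℕ) (p a : Fin m → ℕ) (2≤n : 2 ≤ n)
  (p-prime : ∀ i → Prime (p i)) (p-increasing : ∀ i j → i <F j → p i < p j) (a≥1 : ∀ i → 1 ≤ a i)
  (n≡∏ : n ≡ prodFin (λ i → p i ^ a i))
  (x : ℕ) (1<x : 1 < x)
  (α : Fin m) (τ : Fin (suc m)) (b : ℕ) (φα∈Πτ : InPi p τ (p α))
  where

  instance
    x≢0 : NonZero x
    x≢0 = >-nonZero (<-trans z<s 1<x)
    n≢0 : NonZero n
    n≢0 = >-nonZero (<-trans z<s 2≤n)

  φα : ℕ
  φα = p α

  X : ℕ
  X = x ^ n

  divides? : ℕ → Bool
  divides? q = does (q ∣? (x ^ n ∸ 1))

  inΠ : Fin (suc m) → ℕ → Bool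
  inΠ j q = does (inPi? p j q)

  divisorsIn : Fin (suc m) → ℕ → Bool
  divisorsIn j q = inΠ j q ∧ divides? q

  k : Fin (suc m) → ℕ
  k j = count (divisorsIn j) X

  R : Fin (suc m) → ℕ → ℕ
  R j = nth (inΠ j) X

  divisorsIn⊆inΠ : ∀ j → divisorsIn j ⊆ᵇ inΠ j
  divisorsIn⊆inΠ j q with inΠ j q
  ... | true  = λ _ → refl
  ... | false = λ ()

  k≤ : ∀ j → k j ≤ count (inΠ j) X
  k≤ j = count-mono (divisorsIn⊆inΠ j) X

  inΠ-class : ∀ {q} → Prime q → ∃[ j₀ ] InPi p j₀ q × (∀ j → j ≢ j₀ → inΠ j q ≡ false)
  inΠ-class {q} pr with j₀ , q∈Πj₀ ← InPi-exists p pr =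
    j₀ , q∈Πj₀ , λ j j≢j₀ → dec-false (inPi? p j q) (j≢j₀ ∘ flip (InPi-unique p) q∈Πj₀)

  inΠ-nonprime : ∀ {q} → ¬ Prime q → ∀ j → inΠ j q ≡ false
  inΠ-nonprime {q} ¬pr j = dec-false (inPi? p j q) (¬pr ∘ proj₁)

  sum-k≡omega : sumFin k ≡ omega x n
  sum-k≡omega = trans (sumFin-count divisorsIn (λ q → does (prime? q) ∧ divides? q) pointwise X)
                      (sym (count-filter (λ q → prime? q ×-dec (q ∣? (x ^ n ∸ 1))) X))
    where
      pointwise : ∀ q → sumFin (λ j → 𝟙 (divisorsIn j q)) ≡ 𝟙 (does (prime? q) ∧ divides? q)
      pointwise q = by-primality (prime? q)
        where
          by-primality : Dec (Prime q) → sumFin (λ j → 𝟙 (divisorsIn j q)) ≡ 𝟙 (does (prime? q) ∧ divides? q)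
          by-primality (yes pr) with j₀ , q∈Πj₀ , q∉Πj ← inΠ-class pr =
            trans (sumFin-single _ j₀ λ j j≢j₀ → cong (λ c → 𝟙 (c ∧ divides? q)) (q∉Πj j j≢j₀))
                  (cong (λ c → 𝟙 (c ∧ divides? q))
                        (trans (dec-true (inPi? p j₀ q) q∈Πj₀) (sym (dec-true (prime? q) pr))))
          by-primality (no ¬pr) =
            trans (sumFin-0 _ λ j → cong (λ c → 𝟙 (c ∧ divides? q)) (inΠ-nonprime ¬pr j))
                  (cong (λ c → 𝟙 (c ∧ divides? q)) (sym (dec-false (prime? q) ¬pr)))

  IsNth-R : ∀ j i → 1 ≤ i → i ≤ count (inΠ j) X → IsNth p j i (R j i)
  IsNth-R j i 1≤i i≤c with r∈Πj , below-r ← nth-spec (inΠ j) X i 1≤i i≤c =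
    1≤i , does-true⇒ (inPi? p j (R j i)) r∈Πj , trans (count-filter (inPi? p j) (R j i)) below-r

  φα-prime : Prime φα
  φα-prime = p-prime α

  φα∈Πτ-true : inΠ τ φα ≡ true
  φα∈Πτ-true = dec-true (inPi? p τ φα) φα∈Πτ

  φα<X : φα < X
  φα<X = ≤-<-trans (∣⇒≤ (∣-trans (φα∣φα^ (a α) (a≥1 α)) φα^aα∣n)) (n<m^n x n 1<x)
    where φα∣φα^ : ∀ e → 1 ≤ e → φα ∣ φα ^ e
          φα∣φα^ (suc e) _ = m∣m*n (φα ^ e)
          φα^aα∣n : φα ^ a α ∣ n
          φα^aα∣n = subst (φα ^ a α ∣_) (sym n≡∏) (∣-prodFin (λ i → p i ^ a i) α)

  φα∸1<φα : φα ∸ 1 < φα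
  φα∸1<φα = ∸-monoʳ-< z<s (>-nonZero⁻¹ φα {{prime⇒nonZero φα-prime}})

  instance
    φα∸1≢0 : NonZero (φα ∸ 1)
    φα∸1≢0 = >-nonZero (m<n⇒0<n∸m (nonTrivial⇒n>1 φα {{prime⇒nonTrivial φα-prime}}))

  φα∈divisorsIn-τ : divisorsIn τ φα ≡ DivCase p α x n
  φα∈divisorsIn-τ = cong (_∧ divides? φα) φα∈Πτ-true

  1≤kτ : DivCase p α x n ≡ true → 1 ≤ k τ
  1≤kτ dc = subst (1 ≤_) (sym (count-remove (trans φα∈divisorsIn-τ dc) φα<X)) (s≤s z≤n)

  1+kτ≤ : DivCase p α x n ≡ false → suc (k τ) ≤ count (inΠ τ) X
  1+kτ≤ dc = subst (_≤ count (inΠ τ) X) (count-insert (trans φα∈divisorsIn-τ dc) φα<X)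
                   (count-mono (insert-⊆ᵇ (divisorsIn⊆inΠ τ) φα∈Πτ-true) X)

  admissible : Admissible p x n α τ b k R
  admissible = (λ j i 1≤i i≤k → IsNth-R j i 1≤i (≤-trans i≤k (k≤ j))) ,
               (λ dc _ → IsNth-R τ (k τ) (1≤kτ dc) (k≤ τ)) ,
               (λ dc _ → IsNth-R τ (suc (k τ)) (s≤s z≤n) (1+kτ≤ dc))

  R-nonZero : ∀ j i → 1 ≤ i → i ≤ count (inΠ j) X → NonZero (R j i)
  R-nonZero j i 1≤i i≤c = prime⇒nonZero (proj₁ (proj₁ (proj₂ (IsNth-R j i 1≤i i≤c))))

  rProduct : Fin (suc m) → ℕ
  rProduct j = prodRange (R j) (k j)

  divisorProduct : Fin (suc m) → ℕ
  divisorProduct j = prod (divisorsIn j) X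

  rProduct≤divisorProduct : ∀ j → rProduct j ≤ divisorProduct j
  rProduct≤divisorProduct j = prodRange-nth≤prod (inΠ j) X (divisorsIn⊆inΠ j) X (k≤ j)

  φα-factor : Fin (suc m) → ℕ
  φα-factor j = if DivCase p α x n ∧ does (j ≟F fsuc α) then φα ^ a α else 1

  -- A bound for δ_α(j) · rProduct j (δ-bound) chosen so that the majorants with j ≤ t multiply to
  -- a divisor of x^{1/T(t)} − 1 (∏majorant∣x^T⁻¹∸1).
  majorant : Fin (suc m) → ℕ
  majorant j = divisorProduct j * φα-factor j

  δ : Fin (suc m) → ℚ
  δ = delta p a x n α τ b k R

  τ≢α+1 : τ ≢ fsuc α
  τ≢α+1 τ≡α+1 = >⇒∤ φα∸1<φα (subst (λ j → φ p j ∣ φα ∸ 1) τ≡α+1 (proj₁ (proj₂ φα∈Πτ)))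

  trivial-bound : ∀ j → FractionBound 1ℚ (rProduct j) (divisorProduct j * 1)
  trivial-bound j =
    1 , 1 , _ , refl , *-monoʳ-≤ 1 (subst (rProduct j ≤_) (sym (*-identityʳ _)) (rProduct≤divisorProduct j))

  δ-bound : ∀ j → FractionBound (δ j) (rProduct j) (majorant j)
  δ-bound j with DivCase p α x n in dc | j ≟F τ | j ≟F fsuc α
  ... | true  | yes refl | yes τ≡α+1 = contradiction τ≡α+1 τ≢α+1
  ... | true  | yes refl | no  _ with k τ <ᵇ b
  ...   | true  = φα , R τ (k τ) , R-nonZero τ (k τ) (1≤kτ dc) (k≤ τ) , refl ,
                  subst (φα * rProduct τ ≤_) (cong (R τ (k τ) *_) (sym (*-identityʳ (divisorProduct τ))))
                    (prodRange-nth≤prod-remove (inΠ τ) X (divisorsIn⊆inΠ τ) X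
                                               (trans φα∈divisorsIn-τ dc) φα<X (k≤ τ))
  ...   | false = trivial-bound j
  δ-bound j | true  | no  _    | yes refl = φα ^ a α , 1 , _ , refl ,
                  subst₂ _≤_ (*-comm (rProduct (fsuc α)) (φα ^ a α))
                             (sym (*-identityˡ (divisorProduct (fsuc α) * φα ^ a α)))
                    (*-monoˡ-≤ (φα ^ a α) (rProduct≤divisorProduct (fsuc α)))
  δ-bound j | true  | no  _    | no  _    = trivial-bound j
  δ-bound j | false | yes refl | _ with b ≤ᵇ k τ
  ...   | true  = R τ (suc (k τ)) , φα , prime⇒nonZero φα-prime , refl ,
                  subst (R τ (suc (k τ)) * rProduct τ ≤_) (cong (φα *_) (sym (*-identityʳ (divisorProduct τ))))
                    (prodRange-nth≤prod-insert (inΠ τ) X (divisorsIn⊆inΠ τ) X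
                                               (trans φα∈divisorsIn-τ dc) φα∈Πτ-true φα<X (1+kτ≤ dc))
  ...   | false = trivial-bound j
  δ-bound j | false | no  _    | _        = trivial-bound j

  T⁻¹ : Fin (suc m) → ℕ
  T⁻¹ t = invT p a t

  cofactor : Fin (suc m) → ℕ
  cofactor t = prodFin (λ i → if toℕ i <ᵇ toℕ t then 1 else p i ^ a i)

  n≡T⁻¹*cofactor : ∀ t → n ≡ T⁻¹ t * cofactor t
  n≡T⁻¹*cofactor t = trans n≡∏ (trans (prodFin-cong λ i → split (toℕ i <ᵇ toℕ t) (p i ^ a i))
    (prodFin-distrib-* (λ i → if toℕ i <ᵇ toℕ t then p i ^ a i else 1) (λ i → if toℕ i <ᵇ toℕ t then 1 else p i ^ a i)))
    where split : ∀ c y → y ≡ (if c then y else 1) * (if c then 1 else y)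
          split true  y = sym (*-identityʳ y)
          split false y = sym (+-identityʳ y)

  T⁻¹≢0 : ∀ t → NonZero (T⁻¹ t)
  T⁻¹≢0 t = m*n≢0⇒m≢0 (T⁻¹ t) {{subst NonZero (n≡T⁻¹*cofactor t) n≢0}}

  cofactor-coprime : ∀ t q → InPi≤ p t q → Coprime (cofactor t) (q ∸ 1)
  cofactor-coprime t q below = coprime-prodFin _ factor
    where
      factor : ∀ i → Coprime (if toℕ i <ᵇ toℕ t then 1 else p i ^ a i) (q ∸ 1)
      factor i with toℕ i <ᵇ toℕ t | <ᵇ-reflects-< (toℕ i) (toℕ t)
      ... | true  | _       = 1-coprimeTo (q ∸ 1)
      ... | false | ofⁿ i≮t = coprime-^ (prime∤⇒coprime (p-prime i) (below (fsuc i) (s≤s (≮⇒≥ i≮t)))) (a i)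

  ∣x^T⁻¹∸1 : ∀ t {q} → Prime q → InPi≤ p t q → q ∣ x ^ n ∸ 1 → q ∣ x ^ T⁻¹ t ∸ 1
  ∣x^T⁻¹∸1 t {q} pr below q∣x^n∸1 =
    ∣x^[m*r]∸1⇒∣x^m∸1 x pr (T⁻¹ t) (cofactor t) {{subst NonZero (n≡T⁻¹*cofactor t) n≢0}} (cofactor-coprime t q below)
      (subst (λ e → q ∣ x ^ e ∸ 1) (n≡T⁻¹*cofactor t) q∣x^n∸1)

  φα-InPi≤ : ∀ t → toℕ α < toℕ t → InPi≤ p t φα
  φα-InPi≤ t α<t (fsuc i) t<i = >⇒∤ (<-trans φα∸1<φα (p-increasing α i (<-≤-trans α<t (s≤s⁻¹ t<i))))

  φα^aα∣T⁻¹ : ∀ t → toℕ α < toℕ t → φα ^ a α ∣ T⁻¹ t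
  φα^aα∣T⁻¹ t α<t
    with toℕ α <ᵇ toℕ t | <ᵇ-reflects-< (toℕ α) (toℕ t) | ∣-prodFin (λ i → if toℕ i <ᵇ toℕ t then p i ^ a i else 1) α
  ... | true  | _       | φα^aα∣ = φα^aα∣
  ... | false | ofⁿ α≮t | _      = contradiction α<t α≮t

  φα^[1+aα]∣x^T⁻¹∸1 : ∀ t → toℕ α < toℕ t → φα ∣ x ^ n ∸ 1 → φα ^ suc (a α) ∣ x ^ T⁻¹ t ∸ 1
  φα^[1+aα]∣x^T⁻¹∸1 t α<t φα∣x^n∸1 with divides M T⁻¹≡M*φα^aα ← φα^aα∣T⁻¹ t α<t =
    subst (λ e → φα ^ suc (a α) ∣ x ^ e ∸ 1) (sym T⁻¹≡M*φα^aα)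
      (lifting-the-exponent x M (a α) (φα∣x^M∸1 M T⁻¹≡M*φα^aα))
    where
      φα∣x^M∸1 : ∀ M → T⁻¹ t ≡ M * φα ^ a α → φα ∣ x ^ M ∸ 1
      φα∣x^M∸1 M T⁻¹≡M*φα^aα = ∣x^[m*r]∸1⇒∣x^m∸1 x φα-prime M (φα ^ a α * cofactor t) {{subst NonZero n≡ n≢0}}
        (coprime-*ˡ (coprime-^ (prime∤⇒coprime φα-prime (>⇒∤ φα∸1<φα)) (a α))
                    (cofactor-coprime t φα (φα-InPi≤ t α<t)))
        (subst (λ e → φα ∣ x ^ e ∸ 1) n≡ φα∣x^n∸1)
        where n≡ : n ≡ M * (φα ^ a α * cofactor t)
              n≡ = trans (n≡T⁻¹*cofactor t)
                         (trans (cong (_* cofactor t) T⁻¹≡M*φα^aα) (*-assoc M (φα ^ a α) (cofactor t)))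

  _≤ᶠ_ : Fin (suc m) → Fin (suc m) → Bool
  j ≤ᶠ t = toℕ j ≤ᵇ toℕ t

  divisorsUpTo? : ∀ t q → Dec (Prime q × q ∣ x ^ n ∸ 1 × InPi≤ p t q)
  divisorsUpTo? t q = prime? q ×-dec q ∣? (x ^ n ∸ 1) ×-dec inPi≤? p t q

  divisorsUpTo : Fin (suc m) → ℕ → Bool
  divisorsUpTo t q = does (divisorsUpTo? t q)

  divisorsUpTo⇒ : ∀ t q → q < X → divisorsUpTo t q ≡ true → Prime q × q ∣ x ^ T⁻¹ t ∸ 1
  divisorsUpTo⇒ t q _ q∈ with pr , q∣x^n∸1 , below ← does-true⇒ (divisorsUpTo? t q) q∈ =
    pr , ∣x^T⁻¹∸1 t pr below q∣x^n∸1

  ≤ᶠ≡InPi≤? : ∀ {j t q} → InPi p j q → (j ≤ᶠ t) ≡ does (inPi≤? p t q)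
  ≤ᶠ≡InPi≤? {j} {t} {q} q∈Πj with j ≤ᶠ t | ≤ᵇ-reflects-≤ (toℕ j) (toℕ t)
  ... | true  | ofʸ j≤t = sym (dec-true (inPi≤? p t q) (InPi⇒InPi≤ p q∈Πj j≤t))
  ... | false | ofⁿ j≰t = sym (dec-false (inPi≤? p t q) (j≰t ∘ InPi≤⇒≤ p q∈Πj))

  divisorsUpTo-by-class : ∀ t q → prodFin (λ j → if divisorsIn j q ∧ (j ≤ᶠ t) then q else 1)
                                 ≡ (if divisorsUpTo t q then q else 1)
  divisorsUpTo-by-class t q = by-primality (prime? q)
    where
      by-primality : Dec (Prime q) → prodFin (λ j → if divisorsIn j q ∧ (j ≤ᶠ t) then q else 1)
                                     ≡ (if divisorsUpTo t q then q else 1)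
      by-primality (yes pr) with j₀ , q∈Πj₀ , q∉Πj ← inΠ-class pr =
        trans (prodFin-single _ j₀ λ j j≢j₀ → cong (λ c → if (c ∧ divides? q) ∧ (j ≤ᶠ t) then q else 1) (q∉Πj j j≢j₀))
              (cong (if_then q else 1) (begin
                (inΠ j₀ q ∧ divides? q) ∧ (j₀ ≤ᶠ t)
                  ≡⟨ cong (λ c → (c ∧ divides? q) ∧ (j₀ ≤ᶠ t)) (dec-true (inPi? p j₀ q) q∈Πj₀) ⟩
                divides? q ∧ (j₀ ≤ᶠ t)
                  ≡⟨ cong (divides? q ∧_) (≤ᶠ≡InPi≤? q∈Πj₀) ⟩
                divides? q ∧ does (inPi≤? p t q)
                  ≡⟨ cong (_∧ (divides? q ∧ does (inPi≤? p t q))) (dec-true (prime? q) pr) ⟨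
                divisorsUpTo t q
                  ∎))
        where open ≡-Reasoning
      by-primality (no ¬pr) =
        trans (prodFin-1 _ λ j → cong (λ c → if (c ∧ divides? q) ∧ (j ≤ᶠ t) then q else 1) (inΠ-nonprime ¬pr j))
              (cong (λ c → if c ∧ (divides? q ∧ does (inPi≤? p t q)) then q else 1) (sym (dec-false (prime? q) ¬pr)))

  ∏divisorProduct≡prod-divisorsUpTo : ∀ t → prodFin (λ j → if j ≤ᶠ t then divisorProduct j else 1)
                                          ≡ prod (divisorsUpTo t) X
  ∏divisorProduct≡prod-divisorsUpTo t =
    trans (prodFin-cong λ j → prod-if (j ≤ᶠ t) (divisorsIn j) X)
          (prodFin-prod (λ j q → divisorsIn j q ∧ (j ≤ᶠ t)) (divisorsUpTo t) (divisorsUpTo-by-class t) X)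

  ∏φα-factor≡ : ∀ t → prodFin (λ j → if j ≤ᶠ t then φα-factor j else 1)
                      ≡ (if fsuc α ≤ᶠ t then (if DivCase p α x n then φα ^ a α else 1) else 1)
  ∏φα-factor≡ t = trans (prodFin-single (λ j → if j ≤ᶠ t then φα-factor j else 1) (fsuc α) elsewhere)
                        (cong (if fsuc α ≤ᶠ t then_else 1) at-α)
    where
      elsewhere : ∀ j → j ≢ fsuc α → (if j ≤ᶠ t then φα-factor j else 1) ≡ 1
      elsewhere j j≢α+1 rewrite dec-false (j ≟F fsuc α) j≢α+1 | ∧-zeroʳ (DivCase p α x n) = if-eta (j ≤ᶠ t)
      at-α : φα-factor (fsuc α) ≡ (if DivCase p α x n then φα ^ a α else 1)
      at-α rewrite dec-true (fsuc α ≟F fsuc α) refl | ∧-identityʳ (DivCase p α x n) = refl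

  ∏majorant≡ : ∀ t → prodFin (λ j → if j ≤ᶠ t then majorant j else 1)
                   ≡ prod (divisorsUpTo t) X * (if fsuc α ≤ᶠ t then (if DivCase p α x n then φα ^ a α else 1) else 1)
  ∏majorant≡ t = begin
    prodFin (λ j → if j ≤ᶠ t then divisorProduct j * φα-factor j else 1)
      ≡⟨ prodFin-cong (λ j → if-* {divisorProduct j} {φα-factor j} (j ≤ᶠ t)) ⟩
    prodFin (λ j → (if j ≤ᶠ t then divisorProduct j else 1) * (if j ≤ᶠ t then φα-factor j else 1))
      ≡⟨ prodFin-distrib-* (λ j → if j ≤ᶠ t then divisorProduct j else 1) (λ j → if j ≤ᶠ t then φα-factor j else 1) ⟩
    prodFin (λ j → if j ≤ᶠ t then divisorProduct j else 1) * prodFin (λ j → if j ≤ᶠ t then φα-factor j else 1)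
      ≡⟨ cong₂ _*_ (∏divisorProduct≡prod-divisorsUpTo t) (∏φα-factor≡ t) ⟩
    prod (divisorsUpTo t) X * (if fsuc α ≤ᶠ t then (if DivCase p α x n then φα ^ a α else 1) else 1) ∎
    where
      open ≡-Reasoning
      if-* : ∀ {u v} c → (if c then u * v else 1) ≡ (if c then u else 1) * (if c then v else 1)
      if-* true  = refl
      if-* false = refl

  prod-divisorsUpTo∣x^T⁻¹∸1 : ∀ t → prod (divisorsUpTo t) X ∣ x ^ T⁻¹ t ∸ 1
  prod-divisorsUpTo∣x^T⁻¹∸1 t = prod-primes-∣ (divisorsUpTo⇒ t)

  prod-divisorsUpTo*φα^aα∣x^T⁻¹∸1 : ∀ t → toℕ α < toℕ t → φα ∣ x ^ n ∸ 1 →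
                                    prod (divisorsUpTo t) X * φα ^ a α ∣ x ^ T⁻¹ t ∸ 1
  prod-divisorsUpTo*φα^aα∣x^T⁻¹∸1 t α<t φα∣x^n∸1 =
    subst (_∣ x ^ T⁻¹ t ∸ 1) (sym rearrange) (coprime⇒*∣ φα^[1+aα]⊥others (φα^[1+aα]∣x^T⁻¹∸1 t α<t φα∣x^n∸1) others∣)
    where
      others = remove φα (divisorsUpTo t)
      others-divisors : ∀ q → q < X → others q ≡ true → Prime q × q ∣ x ^ T⁻¹ t ∸ 1
      others-divisors q q<X = divisorsUpTo⇒ t q q<X ∘ remove⊆ (divisorsUpTo t) φα q
      others∣ : prod others X ∣ x ^ T⁻¹ t ∸ 1
      others∣ = prod-primes-∣ others-divisors
      φα^[1+aα]⊥others : Coprime (φα ^ suc (a α)) (prod others X)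
      φα^[1+aα]⊥others = coprime-^ (prime∤⇒coprime φα-prime (prime∤prod φα-prime λ q q<X q∈ →
        proj₁ (others-divisors q q<X q∈) , remove⇒≢ {divisorsUpTo t} q∈)) (suc (a α))
      φα∈ : divisorsUpTo t φα ≡ true
      φα∈ = dec-true (divisorsUpTo? t φα) (φα-prime , φα∣x^n∸1 , φα-InPi≤ t α<t)
      rearrange : prod (divisorsUpTo t) X * φα ^ a α ≡ φα ^ suc (a α) * prod others X
      rearrange = trans (cong (_* φα ^ a α) (prod-remove φα∈ φα<X)) (swap φα (prod others X) (φα ^ a α))
        where swap : ∀ u v w → u * v * w ≡ u * w * v
              swap = solve-∀

  ∏majorant∣x^T⁻¹∸1 : ∀ t → prodFin (λ j → if j ≤ᶠ t then majorant j else 1) ∣ x ^ T⁻¹ t ∸ 1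
  ∏majorant∣x^T⁻¹∸1 t = subst (_∣ x ^ T⁻¹ t ∸ 1) (sym (∏majorant≡ t)) by-cases
    where
      by-cases : prod (divisorsUpTo t) X * (if fsuc α ≤ᶠ t then (if DivCase p α x n then φα ^ a α else 1) else 1)
                 ∣ x ^ T⁻¹ t ∸ 1
      by-cases with fsuc α ≤ᶠ t | ≤ᵇ-reflects-≤ (suc (toℕ α)) (toℕ t) | DivCase p α x n in dc
      ... | true  | ofʸ α<t | true  =
        prod-divisorsUpTo*φα^aα∣x^T⁻¹∸1 t α<t (does-true⇒ (φα ∣? (x ^ n ∸ 1)) dc)
      ... | true  | _       | false = subst (_∣ x ^ T⁻¹ t ∸ 1) (sym (*-identityʳ _)) (prod-divisorsUpTo∣x^T⁻¹∸1 t)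
      ... | false | _       | _     = subst (_∣ x ^ T⁻¹ t ∸ 1) (sym (*-identityʳ _)) (prod-divisorsUpTo∣x^T⁻¹∸1 t)

  2≤x^e : ∀ e → .{{NonZero e}} → 2 ≤ x ^ e
  2≤x^e (suc e) = ≤-trans 1<x (m≤m^[1+n] x e)

  ∏majorant<x^T⁻¹ : ∀ t → prodFin (λ j → if j ≤ᶠ t then majorant j else 1) < x ^ T⁻¹ t
  ∏majorant<x^T⁻¹ t = ≤-<-trans (∣⇒≤ {{x^T⁻¹∸1≢0}} (∏majorant∣x^T⁻¹∸1 t)) (∸-monoʳ-< z<s (≤-trans (s≤s z≤n) 2≤x^T⁻¹))
    where
      2≤x^T⁻¹ : 2 ≤ x ^ T⁻¹ t
      2≤x^T⁻¹ = 2≤x^e (T⁻¹ t) {{T⁻¹≢0 t}}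
      x^T⁻¹∸1≢0 : NonZero (x ^ T⁻¹ t ∸ 1)
      x^T⁻¹∸1≢0 = >-nonZero (∸-monoˡ-≤ 1 2≤x^T⁻¹)

  bound : ∀ t → RootLe (base p a x n α τ b k R t) (invT p a t) x
  bound t = 1+≤fromℕ (proj₂ (prodFinℚ≤fromℕ-prodFin _ (λ j → if j ≤ᶠ t then majorant j else 1)
                                λ j → if-bound (j ≤ᶠ t) (FractionBound⇒ (δ-bound j))))
                     (∏majorant<x^T⁻¹ t)

theorem1p2 : (n m : ℕ) (p a : Fin m → ℕ) → 2 ≤ n
    → (∀ i → Prime (p i)) → (∀ i j → i <F j → p i < p j) → (∀ i → 1 ≤ a i)
    → n ≡ prodFin (λ i → p i ^ a i)
    → (x : ℕ) → 1 < x
    → (α : Fin m) (τ : Fin (suc m)) (b : ℕ)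
    → InPi p τ (p α) → IsNth p τ b (p α)
    → ∃[ k ] ∃[ R ] (sumFin k ≡ omega x n)
        × Admissible p x n α τ b k R
        × (∀ t → RootLe (base p a x n α τ b k R t) (invT p a t) x)
theorem1p2 n m p a 2≤n p-prime p-increasing a≥1 n≡∏ x 1<x α τ b φα∈Πτ _ =
  k , R , sum-k≡omega , admissible , bound
  where open Setting n m p a 2≤n p-prime p-increasing a≥1 n≡∏ x 1<x α τ b φα∈Πτ
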